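{- Let $\mathcal{A}$ be a set of modalities, let $\Gamma\subseteq \mathrm{Fm}(\mathcal{A})$ be a $\mathrm{Sub}$-closed set of formulas, and let $M=(W,(R_\Diamond)_{\Diamond\in\mathcal{A}},\vartheta)$ be a Kripke model. Suppose that $\Delta$ is a finite set of formulas and that $\widehat{M}=(W/{\sim_\Delta},(\widehat{R}_\Diamond)_{\Diamond\in\mathcal{A}},\widehat{\vartheta})$ is a $\Gamma$-filtration of $M$. Then for every equivalence relation $\sim$ on $W$ with $\sim\;\subseteq\;\sim_\Delta$ there exists a $\Gamma$-filtration $\widehat{M}'$ of $M$ whose carrier is $W/{\sim}$ and such that for every formula $\varphi\in\mathrm{Fm}(\mathcal{A})$: $\widehat{M}\models\varphi$ if and only if $\widehat{M}'\models\varphi$.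
   Context: Formulas $\mathrm{Fm}(\mathcal{A})$ are built from propositional variables $p_0,p_1,\dots$ and $\bot$ using $\to$ and unary modalities $\Diamond\in\mathcal{A}$. A model $M=(W,(R_\Diamond)_{\Diamond\in\mathcal{A}},\vartheta)$ has binary relations $R_\Diamond$ on $W$ and a valuation $\vartheta$ of variables in subsets of $W$, with standard Kripke truth ($M,x\models\Diamond\varphi$ iff some $y$ with $xR_\Diamond y$ satisfies $\varphi$); $M\models\varphi$ means $\varphi$ is true at every point. A set of formulas is $\mathrm{Sub}$-closed if it contains all subformulas of its members. For a set of formulas $\Gamma$, $x\sim_\Gamma y$ iff $x$ and $y$ satisfy the same formulas of $\Gamma$ in $M$. A $\Gamma$-filtration of $M$ is a model $(W/{\sim},(\widehat{R}_\Diamond)_{\Diamond\in\mathcal{A}},\widehat{\vartheta})$ where: (1) $\sim$ is an equivalence on $W$ with $\sim\;\subseteq\;\sim_\Gamma$; (2) for every variable $p\in\Gamma$, $[x]\in\widehat{\vartheta}(p)$ iff $M,x\models p$ ($[x]$ the $\sim$-class of $x$); (3) for every $\Diamond\in\mathcal{A}$, $(R_\Diamond)_\sim\subseteq\widehat{R}_\Diamond\subseteq(R_\Diamond)^\Gamma_\sim$, where $[x](R_\Diamond)_\sim[y]$ iff there are $x'\sim x$, $y'\sim y$ with $x'R_\Diamond y'$, and $[x](R_\Diamond)^\Gamma_\sim[y]$ iff for every $\psi$ with $\Diamond\psi\in\Gamma$, $M,y\models\psi$ implies $M,x\models\Diamond\psi$. -}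

module Defs where

open import Data.Nat using (ℕ)
open import Data.Empty using (⊥)
open import Data.Product using (Σ; _×_; ∃)
open import Data.List using (List)
open import Data.List.Membership.Propositional using (_∈_)
open import Function.Bundles using (_⇔_)
open import Relation.Binary.Core using (Rel)
open import Level using (0ℓ)
open import Relation.Binary.Structures using (IsEquivalence)

data Fm (A : Set) : Set where
  var  : ℕ → Fm A
  bot  : Fm A
  _⇒_  : Fm A → Fm A → Fm A
  ◇    : A → Fm A → Fm A

FmSet : Set → Set₁
FmSet A = Fm A → Set

SubClosed : {A : Set} → FmSet A → Set
SubClosed {A} Γ =
  (∀ (φ ψ : Fm A) → Γ (φ ⇒ ψ) → Γ φ × Γ ψ) × (∀ (a : A) (φ : Fm A) → Γ (◇ a φ) → Γ φ)

record Model (A : Set) : Set₁ where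
  field
    W : Set
    R : A → W → W → Set
    V : ℕ → W → Set
open Model public

_,_⊩_ : {A : Set} (M : Model A) → W M → Fm A → Set
M , x ⊩ var p   = V M p x
M , x ⊩ bot     = ⊥
M , x ⊩ (φ ⇒ ψ) = M , x ⊩ φ → M , x ⊩ ψ
M , x ⊩ ◇ a φ   = Σ (W M) (λ y → R M a x y × M , y ⊩ φ)

_⊨_ : {A : Set} (M : Model A) → Fm A → Set
M ⊨ φ = ∀ x → M , x ⊩ φ

Equiv[_] : {A : Set} (M : Model A) → FmSet A → Rel (W M) 0ℓ
Equiv[ M ] Γ x y = ∀ φ → Γ φ → (M , x ⊩ φ ⇔ M , y ⊩ φ)

EquivL[_] : {A : Set} (M : Model A) → List (Fm A) → Rel (W M) 0ℓ
EquivL[ M ] Δ x y = ∀ φ → φ ∈ Δ → (M , x ⊩ φ ⇔ M , y ⊩ φ)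

_⊆ʳ_ : {X : Set} → Rel X 0ℓ → Rel X 0ℓ → Set
_⊆ʳ_ {X} P Q = ∀ (x y : X) → P x y → Q x y

-- Quotients are not available: a model on W/∼ is represented as a model on W
-- whose relations and valuation are ∼-invariant ([x] ↦ x). Truth at [x] in the
-- quotient model is truth at x in this representation.
record QModel {A : Set} (M : Model A) (_∼_ : Rel (W M) 0ℓ) : Set₁ where
  field
    Rq : A → W M → W M → Set
    Vq : ℕ → W M → Set
    Rq-resp : ∀ a x x' y y' → x ∼ x' → y ∼ y' → Rq a x y → Rq a x' y'
    Vq-resp : ∀ p x x' → x ∼ x' → Vq p x → Vq p x'

  asModel : Model A
  asModel = record { W = W M ; R = Rq ; V = Vq }
open QModel public

Rmin : {A : Set} (M : Model A) (_∼_ : Rel (W M) 0ℓ) → A → Rel (W M) 0ℓ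
Rmin M _∼_ a x y = Σ (W M) λ x' → Σ (W M) λ y' → x' ∼ x × y' ∼ y × R M a x' y'

Rmax : {A : Set} (M : Model A) (Γ : FmSet A) → A → Rel (W M) 0ℓ
Rmax M Γ a x y = ∀ ψ → Γ (◇ a ψ) → M , y ⊩ ψ → M , x ⊩ ◇ a ψ

record IsFiltration {A : Set} (M : Model A) (Γ : FmSet A) (_∼_ : Rel (W M) 0ℓ)
                    (N : QModel M _∼_) : Set₁ where
  field
    equiv   : IsEquivalence _∼_
    sub     : _∼_ ⊆ʳ Equiv[ M ] Γ
    val     : ∀ p → Γ (var p) → ∀ x → (Vq N p x ⇔ V M p x)
    R-lower : ∀ a → Rmin M _∼_ a ⊆ʳ Rq N a
    R-upper : ∀ a → Rq N a ⊆ʳ Rmax M Γ a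

{-# OPTIONS --safe #-}
-- A filtration on W/∼_Δ is pulled back along the quotient map W/∼ → W/∼_Δ to a
-- Γ-filtration on W/∼: the lower bound is kept because Rmin only grows when ∼ is
-- coarsened, the upper bound and the valuation do not mention ∼ at all. The
-- quotient map is a surjective bounded morphism, so validity is preserved; with
-- quotient models represented as ∼-invariant structures on W the pulled-back model
-- is literally the same model.
module Submission where

open import Defs
open import Data.List using (List)
open import Data.Product using (Σ; _×_; _,_)
open import Function.Bundles using (_⇔_)
open import Function.Construct.Identity using (⇔-id)
open import Relation.Binary.Core using (Rel)
open import Level using (0ℓ)
open import Relation.Binary.Structures using (IsEquivalence)

module _ {A : Set} {M : Model A} {_∼_ _≈_ : Rel (W M) 0ℓ} (∼⊆≈ : _∼_ ⊆ʳ _≈_) where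

  QModel-refine : QModel M _≈_ → QModel M _∼_
  QModel-refine N = record
    { Rq      = Rq N
    ; Vq      = Vq N
    ; Rq-resp = λ a x x' y y' x∼x' y∼y' →
                  Rq-resp N a x x' y y' (∼⊆≈ x x' x∼x') (∼⊆≈ y y' y∼y')
    ; Vq-resp = λ p x x' x∼x' → Vq-resp N p x x' (∼⊆≈ x x' x∼x')
    }

  Rmin-mono : ∀ a → Rmin M _∼_ a ⊆ʳ Rmin M _≈_ a
  Rmin-mono a x y (x' , y' , x'∼x , y'∼y , x'Ry') =
    x' , y' , ∼⊆≈ x' x x'∼x , ∼⊆≈ y' y y'∼y , x'Ry'

  IsFiltration-refine : ∀ {Γ} {N : QModel M _≈_} → IsEquivalence _∼_ →
                        IsFiltration M Γ _≈_ N → IsFiltration M Γ _∼_ (QModel-refine N)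
  IsFiltration-refine ∼-equiv F = record
    { equiv   = ∼-equiv
    ; sub     = λ x y x∼y → sub x y (∼⊆≈ x y x∼y)
    ; val     = val
    ; R-lower = λ a x y xRy → R-lower a x y (Rmin-mono a x y xRy)
    ; R-upper = R-upper
    }
    where open IsFiltration F

  validity-refine : ∀ (N : QModel M _≈_) φ → (asModel N ⊨ φ ⇔ asModel (QModel-refine N) ⊨ φ)
  validity-refine N φ = ⇔-id _

mainTheorem1 : (A : Set) (Γ : FmSet A) → SubClosed Γ → (M : Model A)
    → (Δ : List (Fm A)) (Mh : QModel M (EquivL[ M ] Δ))
    → IsFiltration M Γ (EquivL[ M ] Δ) Mh
    → (_∼_ : Rel (W M) 0ℓ) → IsEquivalence _∼_ → _∼_ ⊆ʳ EquivL[ M ] Δ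
    → Σ (QModel M _∼_) λ Mh' → IsFiltration M Γ _∼_ Mh'
        × (∀ (φ : Fm A) → (asModel Mh ⊨ φ ⇔ asModel Mh' ⊨ φ))
mainTheorem1 A Γ _ M Δ Mh F _∼_ ∼-equiv ∼⊆∼Δ =
  QModel-refine ∼⊆∼Δ Mh , IsFiltration-refine ∼⊆∼Δ ∼-equiv F , validity-refine ∼⊆∼Δ Mh
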